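{- Let $X=\mathrm{Fl}(a,b;n)$. Let $P$ be any right-side-up equilateral triangle of side $n$ made from puzzle pieces (in any orientation) with matching side labels, and let $u$, $v$, $w$ be the strings of labels on its left, right and bottom border segments, read from left to right (so $\partial P=\triangle^{u,v}_w$). If $u$ and $v$ are 012-strings for $X$, then so is $w$. In particular, $w$ consists of simple labels.
   Context: A 012-string for $X=\mathrm{Fl}(a,b;n)$ is a string of length $n$ consisting of $a$ zeros, $b-a$ ones and $n-b$ twos. Labels are the integers $0,\dots,7$; $0,1,2$ are simple. Work in the plane tiled by unit equilateral triangles with a horizontal side. A triangular puzzle piece is a unit triangle whose labels, read counterclockwise, form a cyclic rotation of one of $(0,0,0),(1,1,1),(2,2,2),(3,0,1),(4,1,2),(5,0,2),(6,3,2),(7,0,4)$. An equivariant puzzle piece is a unit rhombus obtained by rotating by a multiple of $60^\circ$ a vertical rhombus (vertices top, bottom, left, right) with label $p$ on its two SW–NE sides and label $q$ on its two NW–SE sides, $(p,q)\in\{(0,1),(1,2),(0,2),(3,2),(0,4),(3,4),(0,6),(7,2)\}$. Here the labels of $P$ on the boundary are not assumed to be simple. -}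

module Defs where

open import Data.Nat using (ℕ; zero; suc; _+_; _∸_; _≤_; _<_)
open import Data.Fin using (Fin; toℕ; #_) renaming (_≟_ to _≟ᶠ_)
open import Data.Vec using (Vec; tabulate; count)
open import Data.Vec.Relation.Unary.All using (All)
open import Data.List using (List; []; _∷_)
open import Data.List.Membership.Propositional using (_∈_)
open import Data.Product using (_×_; _,_; Σ; ∃)
open import Data.Sum using (_⊎_)
open import Relation.Binary.PropositionalEquality using (_≡_; _≢_)

Label : Set
Label = Fin 8

Simple : Label → Set
Simple l = toℕ l < 3

occ : ∀ {n} → Label → Vec Label n → ℕ
occ c s = count (_≟ᶠ c) s

Is012 : (a b n : ℕ) → Vec Label n → Set
Is012 a b n s =
  All Simple s × occ (# 0) s ≡ a × occ (# 1) s ≡ b ∸ a × occ (# 2) s ≡ n ∸ b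

-- Triangular pieces: labels read counterclockwise are a cyclic
-- rotation of one of the basic triples.

Triple : Set
Triple = Label × Label × Label

basicTriples : List Triple
basicTriples =
  (# 0 , # 0 , # 0) ∷ (# 1 , # 1 , # 1) ∷ (# 2 , # 2 , # 2) ∷
  (# 3 , # 0 , # 1) ∷ (# 4 , # 1 , # 2) ∷ (# 5 , # 0 , # 2) ∷
  (# 6 , # 3 , # 2) ∷ (# 7 , # 0 , # 4) ∷ []

rot : Triple → Triple
rot (x , y , z) = (y , z , x)

TriOK : Label → Label → Label → Set
TriOK x y z = Σ Triple λ t → t ∈ basicTriples ×
  ((x , y , z) ≡ t ⊎ (x , y , z) ≡ rot t ⊎ (x , y , z) ≡ rot (rot t))

rhombPairs : List (Label × Label)
rhombPairs =
  (# 0 , # 1) ∷ (# 1 , # 2) ∷ (# 0 , # 2) ∷ (# 3 , # 2) ∷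
  (# 0 , # 4) ∷ (# 3 , # 4) ∷ (# 0 , # 6) ∷ (# 7 , # 2) ∷ []

RhOK : Label → Label → Set
RhOK p q = (p , q) ∈ rhombPairs

-- Lattice point (i , j) = i·e₁ + j·e₂ with e₁ = (1,0),
-- e₂ = (1/2, √3/2).  The big triangle of side n has corners (0,0)
-- (bottom-left), (n,0) (bottom-right), (0,n) (top).
-- Unit edges, each indexed by (i , j) with i + j < n:
--   H (i , j) : (i,j) — (i+1,j)       horizontal
--   D (i , j) : (i,j) — (i,j+1)       SW–NE  ( / )
--   A (i , j) : (i+1,j) — (i,j+1)     NW–SE  ( \ )
-- Up triangle (i , j), i + j < n     : edges H(i,j), A(i,j), D(i,j)
--   (in counterclockwise order).
-- Down triangle (i , j), i + j + 2 ≤ n : edges D(i+1,j), H(i,j+1), A(i,j)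
--   (in counterclockwise order).
-- Label functions are total on ℕ × ℕ; values outside the triangle are
-- irrelevant (never constrained nor used).

data Dir : Set where
  dH dD dA : Dir

-- Each unit triangle is either a triangular piece by itself, or is glued
-- across its edge of the given direction to the neighbouring triangle,
-- forming a rhombus (equivariant piece).
data Choice : Set where
  alone : Choice
  glued : Dir → Choice

record Puzzle (n : ℕ) : Set where
  field
    lH lD lA : ℕ → ℕ → Label
    upC downC : ℕ → ℕ → Choice
    -- gluing is symmetric (each rhombus = one up + one down triangle)
    symH : ∀ i j → 2 + i + j ≤ n →
      (upC i (suc j) ≡ glued dH → downC i j ≡ glued dH) ×
      (downC i j ≡ glued dH → upC i (suc j) ≡ glued dH)
    symD : ∀ i j → 2 + i + j ≤ n →
      (upC (suc i) j ≡ glued dD → downC i j ≡ glued dD) ×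
      (downC i j ≡ glued dD → upC (suc i) j ≡ glued dD)
    symA : ∀ i j → 2 + i + j ≤ n →
      (upC i j ≡ glued dA → downC i j ≡ glued dA) ×
      (downC i j ≡ glued dA → upC i j ≡ glued dA)
    bdH : ∀ i → i < n → upC i 0 ≢ glued dH
    bdD : ∀ j → j < n → upC 0 j ≢ glued dD
    bdA : ∀ i j → suc (i + j) ≡ n → upC i j ≢ glued dA
    upTri : ∀ i j → i + j < n → upC i j ≡ alone →
      TriOK (lH i j) (lA i j) (lD i j)
    downTri : ∀ i j → 2 + i + j ≤ n → downC i j ≡ alone →
      TriOK (lD (suc i) j) (lH i (suc j)) (lA i j)
    -- equivariant pieces: if the internal edge has direction H, the
    -- labels are p on the SW–NE (D) sides and q on the NW–SE (A) sides;
    -- internal D: p on A sides, q on H sides; internal A: p on H sides,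
    -- q on D sides (rotations by multiples of 60°).
    rhH : ∀ i j → 2 + i + j ≤ n → downC i j ≡ glued dH →
      RhOK (lD (suc i) j) (lA i j) ×
      lD (suc i) j ≡ lD i (suc j) × lA i j ≡ lA i (suc j)
    rhD : ∀ i j → 2 + i + j ≤ n → downC i j ≡ glued dD →
      RhOK (lA i j) (lH i (suc j)) ×
      lA i j ≡ lA (suc i) j × lH i (suc j) ≡ lH (suc i) j
    rhA : ∀ i j → 2 + i + j ≤ n → downC i j ≡ glued dA →
      RhOK (lH i (suc j)) (lD (suc i) j) ×
      lH i (suc j) ≡ lH i j × lD (suc i) j ≡ lD i j

open Puzzle public

leftStr : ∀ {n} → Puzzle n → Vec Label n
leftStr P = tabulate λ k → lD P 0 (toℕ k)

rightStr : ∀ {n} → Puzzle n → Vec Label n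
rightStr {n} P = tabulate λ k → lA P (toℕ k) (n ∸ suc (toℕ k))

bottomStr : ∀ {n} → Puzzle n → Vec Label n
bottomStr P = tabulate λ k → lH P (toℕ k) 0

-- The proof is a discrete Stokes argument.  A weight system gives every label
-- an integer weight for each edge direction H, A, D; it is balanced when every
-- triangular piece, read from its H side, has total weight zero.  For such a
-- system the weights of the three boundary strings of a puzzle add up to zero
-- (`conservation`): giving the interior edge of each rhombus the value that
-- balances its up triangle balances its down triangle too (opposite sides of
-- a rhombus carry equal labels), and summing triangles strip by strip
-- telescopes to the boundary.  Since the sides are 012-strings, the bottom
-- then has the H-weight of a 012-string (`bottom-weight`).  Explicit balanced
-- systems finish the proof: one whose H-weight is positive exactly on the
-- non-simple labels shows the bottom is simple, and three whose H-weights on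
-- simple labels are unit vectors count its 0s, 1s and 2s.

module Submission where

open import Defs
open import Data.Nat using (ℕ; _≤_)

open import Agda.Builtin.FromNat using (Number; fromNat)
open import Data.Unit using (tt)
import Data.Nat as ℕ
open import Data.Nat using (zero; suc; _∸_; _<_; s≤s)
import Data.Nat.Literals as ℕ-Literals
import Data.Nat.Properties as ℕP
open import Data.Fin using (toℕ; #_)
import Data.Fin.Properties as FinP
open import Data.Integer using (ℤ; +_; 0ℤ; 1ℤ; _+_; _-_; _*_; -_)
import Data.Integer.Literals as ℤ-Literals
import Data.Integer.Properties as ℤP
open import Data.Integer.Tactic.RingSolver using (solve-∀)
open import Algebra.Properties.AbelianGroup ℤP.+-0-abelianGroup using (∙-cancelʳ)
open import Algebra.Properties.CommutativeSemigroup ℤP.+-commutativeSemigroup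
  using (interchange)
import Data.Fin as Fin
open import Data.Vec using (Vec; []; _∷_; tabulate; lookup)
import Data.Vec as Vec
open import Data.Vec.Relation.Unary.All using (All; []; _∷_)
import Data.List.Relation.Unary.All as List
open import Data.List.Relation.Unary.Any using (here; there)
open import Data.Product using (_×_; _,_; proj₁; proj₂)
open import Data.Sum using (_⊎_; inj₁; inj₂)
open import Function using (_∘_)
open import Relation.Binary.PropositionalEquality
open import Relation.Nullary using (contradiction)
open import Relation.Nullary.Decidable using (Dec; True; toWitness; _×-dec_; _→-dec_)
open ≡-Reasoning

instance
  ℕ-number : Number ℕ
  ℕ-number = ℕ-Literals.number
  ℤ-number : Number ℤ
  ℤ-number = ℤ-Literals.number

-- Σ< n f = f 0 + ⋯ + f (n - 1), built from the right, so that a strip of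
-- triangles can be extended by one triangle at a time.
Σ< : ℕ → (ℕ → ℤ) → ℤ
Σ< zero    f = 0ℤ
Σ< (suc n) f = Σ< n f + f n

Σ<-front : ∀ n (f : ℕ → ℤ) → Σ< (suc n) f ≡ f 0 + Σ< n (f ∘ suc)
Σ<-front zero    f = ℤP.+-comm 0ℤ (f 0)
Σ<-front (suc n) f = begin
  Σ< (suc n) f + f (suc n)             ≡⟨ cong (_+ f (suc n)) (Σ<-front n f) ⟩
  f 0 + Σ< n (f ∘ suc) + f (suc n)     ≡⟨ ℤP.+-assoc (f 0) _ _ ⟩
  f 0 + Σ< (suc n) (f ∘ suc)           ∎

Σ<-cong : ∀ n {f g : ℕ → ℤ} → (∀ i → i < n → f i ≡ g i) → Σ< n f ≡ Σ< n g
Σ<-cong zero    _   = refl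
Σ<-cong (suc n) f≗g =
  cong₂ _+_ (Σ<-cong n (λ i i<n → f≗g i (ℕP.m<n⇒m<1+n i<n))) (f≗g n ℕP.≤-refl)

Σ<-+ : ∀ n (f g : ℕ → ℤ) → Σ< n (λ i → f i + g i) ≡ Σ< n f + Σ< n g
Σ<-+ zero    f g = refl
Σ<-+ (suc n) f g = begin
  Σ< n (λ i → f i + g i) + (f n + g n)  ≡⟨ cong (_+ (f n + g n)) (Σ<-+ n f g) ⟩
  Σ< n f + Σ< n g + (f n + g n)         ≡⟨ interchange (Σ< n f) (Σ< n g) (f n) (g n) ⟩
  Σ< (suc n) f + Σ< (suc n) g           ∎

Σ<-reverse : ∀ n (f : ℕ → ℤ) → Σ< n f ≡ Σ< n (λ t → f (n ∸ suc t))
Σ<-reverse zero    f = refl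
Σ<-reverse (suc n) f = begin
  Σ< n f + f n                            ≡⟨ ℤP.+-comm (Σ< n f) (f n) ⟩
  f n + Σ< n f                            ≡⟨ cong (_+_ (f n)) (Σ<-reverse n f) ⟩
  f n + Σ< n (λ t → f (n ∸ suc t))        ≡⟨ Σ<-front n (λ t → f (n ∸ t)) ⟨
  Σ< (suc n) (λ t → f (suc n ∸ suc t))    ∎

mirror : ∀ {n t} → t < n → n ∸ suc (n ∸ suc t) ≡ t
mirror (s≤s t≤m) = ℕP.m∸[m∸n]≡n t≤m

weigh : ∀ {m} → (Label → ℤ) → Vec Label m → ℤ
weigh f []       = 0ℤ
weigh f (x ∷ xs) = f x + weigh f xs

weigh-tabulate : ∀ m (ℓ : ℕ → Label) (f : Label → ℤ) →
  weigh f (tabulate {n = m} (ℓ ∘ toℕ)) ≡ Σ< m (f ∘ ℓ)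
weigh-tabulate zero    ℓ f = refl
weigh-tabulate (suc m) ℓ f = begin
  f (ℓ 0) + weigh f (tabulate {n = m} (ℓ ∘ suc ∘ toℕ))
    ≡⟨ cong (_+_ (f (ℓ 0))) (weigh-tabulate m (ℓ ∘ suc) f) ⟩
  f (ℓ 0) + Σ< m (f ∘ ℓ ∘ suc)
    ≡⟨ Σ<-front m (f ∘ ℓ) ⟨
  Σ< (suc m) (f ∘ ℓ) ∎

record Weights : Set where
  field
    wH wA wD : Label → ℤ

open Weights public

weight : Weights → Dir → Label → ℤ
weight w dH = wH w
weight w dA = wA w
weight w dD = wD w

-- Every triangular piece, read counterclockwise from its horizontal side,
-- has total weight zero.
Balanced : Weights → Set
Balanced w = ∀ {x y z} → TriOK x y z → wH w x + wA w y + wD w z ≡ 0ℤ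

rotate-piece : ∀ {x y z} → TriOK x y z → TriOK y z x
rotate-piece (t , t∈ , inj₁ refl)        = t , t∈ , inj₂ (inj₁ refl)
rotate-piece (t , t∈ , inj₂ (inj₁ refl)) = t , t∈ , inj₂ (inj₂ refl)
rotate-piece (t , t∈ , inj₂ (inj₂ refl)) = t , t∈ , inj₁ refl

-- Balance is a finite check: the three rotations of the eight basic triples.
BalancedAt : Weights → Triple → Set
BalancedAt w (x , y , z) = wH w x + wA w y + wD w z ≡ 0ℤ

BalancedRotations : Weights → Triple → Set
BalancedRotations w t = BalancedAt w t × BalancedAt w (rot t) × BalancedAt w (rot (rot t))

balanced-from-table : ∀ w → List.All (BalancedRotations w) basicTriples → Balanced w
balanced-from-table w table (t , t∈ , reading) = from-rotations (List.lookup table t∈) reading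
  where
  from-rotations : ∀ {x y z t} → BalancedRotations w t →
    (x , y , z) ≡ t ⊎ (x , y , z) ≡ rot t ⊎ (x , y , z) ≡ rot (rot t) →
    BalancedAt w (x , y , z)
  from-rotations (b , _ , _) (inj₁ refl)        = b
  from-rotations (_ , b , _) (inj₂ (inj₁ refl)) = b
  from-rotations (_ , _ , b) (inj₂ (inj₂ refl)) = b

balancedAt? : ∀ w t → Dec (BalancedAt w t)
balancedAt? w (x , y , z) = wH w x + wA w y + wD w z ℤP.≟ 0ℤ

-- For explicit weight systems, the table is checked by evaluation.
balanced-by-computation : ∀ w →
  True (List.all? (λ t → balancedAt? w t ×-dec balancedAt? w (rot t) ×-dec
                         balancedAt? w (rot (rot t))) basicTriples) →
  Balanced w
balanced-by-computation w check = balanced-from-table w (toWitness check)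

glueCorrection : Choice → Dir → ℤ → ℤ
glueCorrection (glued dH) dH x = x
glueCorrection (glued dA) dA x = x
glueCorrection (glued dD) dD x = x
glueCorrection _          _  _ = 0ℤ

glueCorrection-off : ∀ c d x → c ≢ glued d → glueCorrection c d x ≡ 0ℤ
glueCorrection-off alone      d  x _  = refl
glueCorrection-off (glued dH) dH x ne = contradiction refl ne
glueCorrection-off (glued dH) dA x _  = refl
glueCorrection-off (glued dH) dD x _  = refl
glueCorrection-off (glued dA) dH x _  = refl
glueCorrection-off (glued dA) dA x ne = contradiction refl ne
glueCorrection-off (glued dA) dD x _  = refl
glueCorrection-off (glued dD) dH x _  = refl
glueCorrection-off (glued dD) dA x _  = refl
glueCorrection-off (glued dD) dD x ne = contradiction refl ne

glueCorrection-on : ∀ d x → glueCorrection (glued d) d x ≡ x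
glueCorrection-on dH x = refl
glueCorrection-on dA x = refl
glueCorrection-on dD x = refl

defect-cancelsH : ∀ h a d → h - (h + a + d) + a + d ≡ 0ℤ
defect-cancelsH = solve-∀

defect-cancelsA : ∀ h a d → h + (a - (h + a + d)) + d ≡ 0ℤ
defect-cancelsA = solve-∀

defect-cancelsD : ∀ h a d → h + a + (d - (h + a + d)) ≡ 0ℤ
defect-cancelsD = solve-∀

cong-sum₃ : ∀ {h h′ a a′ d d′ : ℤ} → h ≡ h′ → a ≡ a′ → d ≡ d′ →
  h + a + d ≡ h′ + a′ + d′
cong-sum₃ eh ea ed = cong₂ _+_ (cong₂ _+_ eh ea) ed

corrected-sum : ∀ c (h a d : ℤ) → (c ≡ alone → h + a + d ≡ 0ℤ) →
  (h - glueCorrection c dH (h + a + d)) + (a - glueCorrection c dA (h + a + d))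
    + (d - glueCorrection c dD (h + a + d)) ≡ 0ℤ
corrected-sum alone      h a d piece =
  trans (cong-sum₃ (ℤP.+-identityʳ h) (ℤP.+-identityʳ a) (ℤP.+-identityʳ d)) (piece refl)
corrected-sum (glued dH) h a d _ =
  trans (cong-sum₃ {h = h - (h + a + d)} refl (ℤP.+-identityʳ a) (ℤP.+-identityʳ d))
        (defect-cancelsH h a d)
corrected-sum (glued dA) h a d _ =
  trans (cong-sum₃ {a = a - (h + a + d)} (ℤP.+-identityʳ h) refl (ℤP.+-identityʳ d))
        (defect-cancelsA h a d)
corrected-sum (glued dD) h a d _ =
  trans (cong-sum₃ {d = d - (h + a + d)} (ℤP.+-identityʳ h) (ℤP.+-identityʳ a) refl)
        (defect-cancelsD h a d)

-- The algebra of extending a strip by one up and one down triangle: if the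
-- strip X with outer edges a, d₀ balances Y above it, the new up triangle
-- (h′, a′, d′) and the new down triangle (t, a, d′) are balanced, then the
-- longer strip balances Y + t.
extend-strip : ∀ {X Y a d₀ h′ a′ d′ t : ℤ} → X + a + d₀ ≡ Y →
  h′ + a′ + d′ ≡ 0ℤ → t + a + d′ ≡ 0ℤ → X + h′ + a′ + d₀ ≡ Y + t
extend-strip {X} {_} {a} {d₀} {h′} {a′} {d′} {t} refl up down = begin
  X + h′ + a′ + d₀
    ≡⟨ regroup X a d₀ h′ a′ d′ t ⟩
  X + a + d₀ + (h′ + a′ + d′) - (t + a + d′) + t
    ≡⟨ cong₂ (λ u v → X + a + d₀ + u - v + t) up down ⟩
  X + a + d₀ + 0ℤ - 0ℤ + t
    ≡⟨ unpad (X + a + d₀) t ⟩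
  X + a + d₀ + t ∎
  where
  unpad : ∀ Y t → Y + 0ℤ - 0ℤ + t ≡ Y + t
  unpad = solve-∀
  regroup : ∀ X a d₀ h′ a′ d′ t →
    X + h′ + a′ + d₀ ≡ X + a + d₀ + (h′ + a′ + d′) - (t + a + d′) + t
  regroup = solve-∀

≢-along : ∀ {c c′ c″ : Choice} → c ≡ c′ → c′ ≢ c″ → c ≢ c″
≢-along refl ne = ne

module Conservation (w : Weights) (balanced : Balanced w) {n : ℕ} (P : Puzzle n) where

  label : Dir → ℕ → ℕ → Label
  label dH = lH P
  label dA = lA P
  label dD = lD P

  defect : ℕ → ℕ → ℤ
  defect i j = wH w (lH P i j) + wA w (lA P i j) + wD w (lD P i j)

  -- Every edge is charged to the up triangle containing it: it carries its
  -- weight, corrected when it is the interior edge of a rhombus.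
  value : Dir → ℕ → ℕ → ℤ
  value d i j = weight w d (label d i j) - glueCorrection (upC P i j) d (defect i j)

  value-plain : ∀ d i j → upC P i j ≢ glued d → value d i j ≡ weight w d (label d i j)
  value-plain d i j ne = begin
    weight w d (label d i j) - glueCorrection (upC P i j) d (defect i j)
      ≡⟨ cong (_-_ (weight w d (label d i j))) (glueCorrection-off (upC P i j) d _ ne) ⟩
    weight w d (label d i j) - 0ℤ
      ≡⟨ ℤP.+-identityʳ _ ⟩
    weight w d (label d i j) ∎

  value-glued : ∀ d i j → upC P i j ≡ glued d →
    value d i j ≡ weight w d (label d i j) - defect i j
  value-glued d i j eq =
    cong (_-_ (weight w d (label d i j)))
      (trans (cong (λ c → glueCorrection c d (defect i j)) eq) (glueCorrection-on d _))

  up-sum : ∀ i j → i ℕ.+ j < n → value dH i j + value dA i j + value dD i j ≡ 0ℤ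
  up-sum i j lt = corrected-sum (upC P i j) (wH w (lH P i j)) (wA w (lA P i j)) (wD w (lD P i j))
    (balanced ∘ upTri P i j lt)

  -- The down triangle (i , j) has sides H(i , j+1), A(i , j), D(i+1 , j);
  -- it is balanced too: on its own it is a piece, and in a rhombus its sides
  -- carry the labels of the opposite sides of its partner.
  module DownTriangle (i j : ℕ) (le : 2 ℕ.+ i ℕ.+ j ≤ n) where

    plainH : downC P i j ≢ glued dH → value dH i (suc j) ≡ wH w (lH P i (suc j))
    plainH ne = value-plain dH i (suc j) (ne ∘ proj₁ (symH P i j le))

    plainA : downC P i j ≢ glued dA → value dA i j ≡ wA w (lA P i j)
    plainA ne = value-plain dA i j (ne ∘ proj₁ (symA P i j le))

    plainD : downC P i j ≢ glued dD → value dD (suc i) j ≡ wD w (lD P (suc i) j)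
    plainD ne = value-plain dD (suc i) j (ne ∘ proj₁ (symD P i j le))

    Sum : Set
    Sum = value dH i (suc j) + value dA i j + value dD (suc i) j ≡ 0ℤ

    alone-sum : downC P i j ≡ alone → Sum
    alone-sum eq = begin
      value dH i (suc j) + value dA i j + value dD (suc i) j
        ≡⟨ cong-sum₃ (plainH (≢-along eq λ ())) (plainA (≢-along eq λ ()))
                     (plainD (≢-along eq λ ())) ⟩
      wH w (lH P i (suc j)) + wA w (lA P i j) + wD w (lD P (suc i) j)
        ≡⟨ balanced (rotate-piece (downTri P i j le eq)) ⟩
      0ℤ ∎

    rhombusH-sum : downC P i j ≡ glued dH → Sum
    rhombusH-sum eq with rhH P i j le eq
    ... | _ , sameD , sameA = begin
      value dH i (suc j) + value dA i j + value dD (suc i) j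
        ≡⟨ cong-sum₃ (value-glued dH i (suc j) (proj₂ (symH P i j le) eq))
                     (trans (plainA (≢-along eq λ ())) (cong (wA w) sameA))
                     (trans (plainD (≢-along eq λ ())) (cong (wD w) sameD)) ⟩
      h - (h + a + d) + a + d
        ≡⟨ defect-cancelsH h a d ⟩
      0ℤ ∎
      where
      h a d : ℤ
      h = wH w (lH P i (suc j))
      a = wA w (lA P i (suc j))
      d = wD w (lD P i (suc j))

    rhombusA-sum : downC P i j ≡ glued dA → Sum
    rhombusA-sum eq with rhA P i j le eq
    ... | _ , sameH , sameD = begin
      value dH i (suc j) + value dA i j + value dD (suc i) j
        ≡⟨ cong-sum₃ (trans (plainH (≢-along eq λ ())) (cong (wH w) sameH))
                     (value-glued dA i j (proj₂ (symA P i j le) eq))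
                     (trans (plainD (≢-along eq λ ())) (cong (wD w) sameD)) ⟩
      h + (a - (h + a + d)) + d
        ≡⟨ defect-cancelsA h a d ⟩
      0ℤ ∎
      where
      h a d : ℤ
      h = wH w (lH P i j)
      a = wA w (lA P i j)
      d = wD w (lD P i j)

    rhombusD-sum : downC P i j ≡ glued dD → Sum
    rhombusD-sum eq with rhD P i j le eq
    ... | _ , sameA , sameH = begin
      value dH i (suc j) + value dA i j + value dD (suc i) j
        ≡⟨ cong-sum₃ (trans (plainH (≢-along eq λ ())) (cong (wH w) sameH))
                     (trans (plainA (≢-along eq λ ())) (cong (wA w) sameA))
                     (value-glued dD (suc i) j (proj₂ (symD P i j le) eq)) ⟩
      h + a + (d - (h + a + d))
        ≡⟨ defect-cancelsD h a d ⟩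
      0ℤ ∎
      where
      h a d : ℤ
      h = wH w (lH P (suc i) j)
      a = wA w (lA P (suc i) j)
      d = wD w (lD P (suc i) j)

  down-sum : ∀ i j → (le : 2 ℕ.+ i ℕ.+ j ≤ n) → DownTriangle.Sum i j le
  down-sum i j le with downC P i j in eq
  ... | alone    = DownTriangle.alone-sum i j le eq
  ... | glued dH = DownTriangle.rhombusH-sum i j le eq
  ... | glued dA = DownTriangle.rhombusA-sum i j le eq
  ... | glued dD = DownTriangle.rhombusD-sum i j le eq

  level : ℕ → ℤ
  level j = Σ< (n ∸ j) (λ i → value dH i j)

  sides : ℕ → ℤ
  sides t = value dA (n ∸ suc t) t + value dD 0 t

  -- The first k + 1 up and k down triangles of the strip at height j: the
  -- H-edges below, together with the two outer edges, balance the H-edges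
  -- above.
  strip-prefix : ∀ j k → suc k ℕ.+ j ≤ n →
    Σ< (suc k) (λ i → value dH i j) + value dA k j + value dD 0 j
      ≡ Σ< k (λ i → value dH i (suc j))
  strip-prefix j zero    le = trans (cong (λ x → x + value dA 0 j + value dD 0 j)
                                      (ℤP.+-identityˡ (value dH 0 j)))
                                    (up-sum 0 j le)
  strip-prefix j (suc k) le =
    extend-strip {X = Σ< (suc k) (λ i → value dH i j)} {h′ = value dH (suc k) j}
    (strip-prefix j k (ℕP.≤-trans (ℕP.n≤1+n _) le))
    (up-sum (suc k) j le)
    (down-sum k j le)

  level-step : ∀ j → j < n → level j + sides j ≡ level (suc j)
  level-step j j<n = begin
    Σ< (n ∸ j) (λ i → value dH i j) + sides j
      ≡⟨ cong (λ m → Σ< m (λ i → value dH i j) + sides j) (ℕP.+-∸-assoc 1 j<n) ⟩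
    Σ< (suc k) (λ i → value dH i j) + sides j
      ≡⟨ ℤP.+-assoc (Σ< (suc k) (λ i → value dH i j)) (value dA k j) (value dD 0 j) ⟨
    Σ< (suc k) (λ i → value dH i j) + value dA k j + value dD 0 j
      ≡⟨ strip-prefix j k (ℕP.≤-reflexive (trans (sym (ℕP.+-suc k j))
                                                  (ℕP.m∸n+n≡m j<n))) ⟩
    level (suc j) ∎
    where
    k : ℕ
    k = n ∸ suc j

  below : ∀ j → j ≤ n → level 0 + Σ< j sides ≡ level j
  below zero    _   = ℤP.+-identityʳ (level 0)
  below (suc j) j<n = begin
    level 0 + (Σ< j sides + sides j)  ≡⟨ ℤP.+-assoc (level 0) _ _ ⟨
    level 0 + Σ< j sides + sides j    ≡⟨ cong (_+ sides j) (below j (ℕP.<⇒≤ j<n)) ⟩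
    level j + sides j                 ≡⟨ level-step j j<n ⟩
    level (suc j)                     ∎

  -- Boundary edges are never glued, so they carry their plain weights.
  bottom-values : Σ< n (λ i → value dH i 0) ≡ Σ< n (λ i → wH w (lH P i 0))
  bottom-values = Σ<-cong n (λ i i<n → value-plain dH i 0 (bdH P i i<n))

  left-values : Σ< n (λ t → value dD 0 t) ≡ Σ< n (λ t → wD w (lD P 0 t))
  left-values = Σ<-cong n (λ t t<n → value-plain dD 0 t (bdD P t t<n))

  right-values :
    Σ< n (λ t → value dA (n ∸ suc t) t) ≡ Σ< n (λ k → wA w (lA P k (n ∸ suc k)))
  right-values = begin
    Σ< n (λ t → value dA (n ∸ suc t) t)
      ≡⟨ Σ<-cong n (λ t t<n → cong (value dA (n ∸ suc t)) (sym (mirror t<n))) ⟩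
    Σ< n (λ t → diagonal (n ∸ suc t))
      ≡⟨ Σ<-reverse n diagonal ⟨
    Σ< n diagonal
      ≡⟨ Σ<-cong n (λ k k<n → value-plain dA k (n ∸ suc k)
                                (bdA P k (n ∸ suc k) (ℕP.m+[n∸m]≡n k<n))) ⟩
    Σ< n (λ k → wA w (lA P k (n ∸ suc k))) ∎
    where
    diagonal : ℕ → ℤ
    diagonal k = value dA k (n ∸ suc k)

  conservation :
    weigh (wH w) (bottomStr P) + (weigh (wA w) (rightStr P) + weigh (wD w) (leftStr P)) ≡ 0ℤ
  conservation = begin
    weigh (wH w) (bottomStr P) + (weigh (wA w) (rightStr P) + weigh (wD w) (leftStr P))
      ≡⟨ cong₂ _+_ (weigh-tabulate n (λ i → lH P i 0) (wH w))
                   (cong₂ _+_ (weigh-tabulate n (λ k → lA P k (n ∸ suc k)) (wA w))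
                              (weigh-tabulate n (lD P 0) (wD w))) ⟩
    Σ< n (λ i → wH w (lH P i 0))
      + (Σ< n (λ k → wA w (lA P k (n ∸ suc k))) + Σ< n (λ t → wD w (lD P 0 t)))
      ≡⟨ cong₂ _+_ bottom-values (cong₂ _+_ right-values left-values) ⟨
    level 0 + (Σ< n (λ t → value dA (n ∸ suc t) t) + Σ< n (λ t → value dD 0 t))
      ≡⟨ cong (_+_ (level 0)) (Σ<-+ n _ _) ⟨
    level 0 + Σ< n sides
      ≡⟨ below n ℕP.≤-refl ⟩
    level n
      ≡⟨ cong (λ m → Σ< m (λ i → value dH i n)) (ℕP.n∸n≡0 n) ⟩
    0ℤ ∎

Shape : Set
Shape = ℕ × ℕ × ℕ

shape : ∀ {m} → Vec Label m → Shape
shape s = occ (# 0) s , occ (# 1) s , occ (# 2) s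

flagShape : ℕ → ℕ → ℕ → Shape
flagShape a b n = a , b ∸ a , n ∸ b

⟨_∣_⟩ : Shape → (Label → ℤ) → ℤ
⟨ (p , q , r) ∣ f ⟩ = + p * f (# 0) + (+ q * f (# 1) + + r * f (# 2))

count-up₀ : ∀ p q r (f : Label → ℤ) → f (# 0) + ⟨ (p , q , r) ∣ f ⟩ ≡ ⟨ (suc p , q , r) ∣ f ⟩
count-up₀ p q r f = ring (+ p) (+ q) (+ r) (f (# 0)) (f (# 1)) (f (# 2))
  where
  ring : ∀ p q r u v w → u + (p * u + (q * v + r * w)) ≡ (1ℤ + p) * u + (q * v + r * w)
  ring = solve-∀

count-up₁ : ∀ p q r (f : Label → ℤ) → f (# 1) + ⟨ (p , q , r) ∣ f ⟩ ≡ ⟨ (p , suc q , r) ∣ f ⟩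
count-up₁ p q r f = ring (+ p) (+ q) (+ r) (f (# 0)) (f (# 1)) (f (# 2))
  where
  ring : ∀ p q r u v w → v + (p * u + (q * v + r * w)) ≡ p * u + ((1ℤ + q) * v + r * w)
  ring = solve-∀

count-up₂ : ∀ p q r (f : Label → ℤ) → f (# 2) + ⟨ (p , q , r) ∣ f ⟩ ≡ ⟨ (p , q , suc r) ∣ f ⟩
count-up₂ p q r f = ring (+ p) (+ q) (+ r) (f (# 0)) (f (# 1)) (f (# 2))
  where
  ring : ∀ p q r u v w → w + (p * u + (q * v + r * w)) ≡ p * u + (q * v + (1ℤ + r) * w)
  ring = solve-∀

prepend : ∀ {m} (f : Label → ℤ) x (xs : Vec Label m) → Simple x →
  f x + ⟨ shape xs ∣ f ⟩ ≡ ⟨ shape (x ∷ xs) ∣ f ⟩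
prepend f Fin.zero                     xs _ =
  count-up₀ (occ (# 0) xs) (occ (# 1) xs) (occ (# 2) xs) f
prepend f (Fin.suc Fin.zero)           xs _ =
  count-up₁ (occ (# 0) xs) (occ (# 1) xs) (occ (# 2) xs) f
prepend f (Fin.suc (Fin.suc Fin.zero)) xs _ =
  count-up₂ (occ (# 0) xs) (occ (# 1) xs) (occ (# 2) xs) f
prepend f (Fin.suc (Fin.suc (Fin.suc _))) _ (s≤s (s≤s (s≤s ())))

weigh-simple : ∀ {m} (f : Label → ℤ) (s : Vec Label m) → All Simple s →
  weigh f s ≡ ⟨ shape s ∣ f ⟩
weigh-simple f []       []                  = refl
weigh-simple f (x ∷ xs) (x-simple ∷ simple) = begin
  f x + weigh f xs        ≡⟨ cong (_+_ (f x)) (weigh-simple f xs simple) ⟩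
  f x + ⟨ shape xs ∣ f ⟩  ≡⟨ prepend f x xs x-simple ⟩
  ⟨ shape (x ∷ xs) ∣ f ⟩  ∎

weigh-012 : ∀ {a b n} (f : Label → ℤ) (s : Vec Label n) → Is012 a b n s →
  weigh f s ≡ ⟨ flagShape a b n ∣ f ⟩
weigh-012 f s (simple , zeros , ones , twos) =
  trans (weigh-simple f s simple)
        (cong (λ σ → ⟨ σ ∣ f ⟩) (cong₂ _,_ zeros (cong₂ _,_ ones twos)))

pairing-vanishes : ∀ σ → ⟨ σ ∣ (λ _ → 0ℤ) ⟩ ≡ 0ℤ
pairing-vanishes (p , q , r) = annihilate (+ p) (+ q) (+ r)
  where
  annihilate : ∀ x y z → x * 0ℤ + (y * 0ℤ + z * 0ℤ) ≡ 0ℤ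
  annihilate = solve-∀

pairing-balance : ∀ σ (h a d : Label → ℤ) →
  h (# 0) + a (# 0) + d (# 0) ≡ 0ℤ → h (# 1) + a (# 1) + d (# 1) ≡ 0ℤ →
  h (# 2) + a (# 2) + d (# 2) ≡ 0ℤ →
  ⟨ σ ∣ h ⟩ + (⟨ σ ∣ a ⟩ + ⟨ σ ∣ d ⟩) ≡ 0ℤ
pairing-balance σ@(p , q , r) h a d zero₀ zero₁ zero₂ = begin
  ⟨ σ ∣ h ⟩ + (⟨ σ ∣ a ⟩ + ⟨ σ ∣ d ⟩)
    ≡⟨ collect (+ p) (+ q) (+ r) (h (# 0)) (h (# 1)) (h (# 2)) (a (# 0)) (a (# 1)) (a (# 2))
               (d (# 0)) (d (# 1)) (d (# 2)) ⟩
  + p * (h (# 0) + a (# 0) + d (# 0))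
    + (+ q * (h (# 1) + a (# 1) + d (# 1)) + + r * (h (# 2) + a (# 2) + d (# 2)))
    ≡⟨ cong₂ (λ u v → + p * u + v) zero₀ (cong₂ (λ u v → + q * u + + r * v) zero₁ zero₂) ⟩
  ⟨ σ ∣ (λ _ → 0ℤ) ⟩
    ≡⟨ pairing-vanishes σ ⟩
  0ℤ ∎
  where
  collect : ∀ p q r h₀ h₁ h₂ a₀ a₁ a₂ d₀ d₁ d₂ →
    p * h₀ + (q * h₁ + r * h₂) + ((p * a₀ + (q * a₁ + r * a₂)) + (p * d₀ + (q * d₁ + r * d₂)))
      ≡ p * (h₀ + a₀ + d₀) + (q * (h₁ + a₁ + d₁) + r * (h₂ + a₂ + d₂))
  collect = solve-∀

bottom-weight : ∀ {a b n} (w : Weights) → Balanced w → (P : Puzzle n) →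
  Is012 a b n (leftStr P) → Is012 a b n (rightStr P) →
  weigh (wH w) (bottomStr P) ≡ ⟨ flagShape a b n ∣ wH w ⟩
bottom-weight {a} {b} {n} w balanced P left right =
  ∙-cancelʳ (⟨ σ ∣ wA w ⟩ + ⟨ σ ∣ wD w ⟩) _ _ (begin
    weigh (wH w) (bottomStr P) + (⟨ σ ∣ wA w ⟩ + ⟨ σ ∣ wD w ⟩)
      ≡⟨ cong (_+_ (weigh (wH w) (bottomStr P)))
              (cong₂ _+_ (weigh-012 (wA w) _ right) (weigh-012 (wD w) _ left)) ⟨
    weigh (wH w) (bottomStr P) + (weigh (wA w) (rightStr P) + weigh (wD w) (leftStr P))
      ≡⟨ Conservation.conservation w balanced P ⟩
    0ℤ
      ≡⟨ pairing-balance σ (wH w) (wA w) (wD w) (balanced (_ , here refl , inj₁ refl))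
           (balanced (_ , there (here refl) , inj₁ refl))
           (balanced (_ , there (there (here refl)) , inj₁ refl)) ⟨
    ⟨ σ ∣ wH w ⟩ + (⟨ σ ∣ wA w ⟩ + ⟨ σ ∣ wD w ⟩) ∎)
  where
  σ : Shape
  σ = flagShape a b n

excess : Label → ℕ
excess = lookup (0 ∷ 0 ∷ 0 ∷ 1 ∷ 1 ∷ 2 ∷ 2 ∷ 2 ∷ [])

excess-free⇒simple : ∀ l → excess l ≡ 0 → Simple l
excess-free⇒simple =
  toWitness {a? = FinP.all? (λ l → (excess l ℕ.≟ 0) →-dec (toℕ l ℕ.<? 3))} _

weigh-ℕ : ∀ {m} (g : Label → ℕ) (s : Vec Label m) →
  weigh (λ l → + g l) s ≡ + Vec.sum (Vec.map g s)
weigh-ℕ g []       = refl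
weigh-ℕ g (x ∷ xs) = trans (cong (_+_ (+ g x)) (weigh-ℕ g xs)) (sym (ℤP.pos-+ (g x) _))

no-excess⇒simple : ∀ {m} (s : Vec Label m) → Vec.sum (Vec.map excess s) ≡ 0 → All Simple s
no-excess⇒simple []       _     = []
no-excess⇒simple (x ∷ xs) total =
  excess-free⇒simple x (ℕP.m+n≡0⇒m≡0 (excess x) total) ∷
  no-excess⇒simple xs (ℕP.m+n≡0⇒n≡0 (excess x) total)

excessWeights : Weights
excessWeights = record
  { wH = λ l → + excess l
  ; wA = lookup (0 ∷ 1 ∷ 2 ∷ 0 ∷ 1 ∷ 0 ∷ 1 ∷ - 1 ∷ [])
  ; wD = lookup (0 ∷ - 1 ∷ - 2 ∷ - 1 ∷ - 2 ∷ - 2 ∷ - 3 ∷ - 1 ∷ [])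
  }

-- The bottom of a puzzle with 012 sides has the excess of a 012-string,
-- that is none, so it consists of simple labels.
bottom-simple : ∀ {a b n} (P : Puzzle n) →
  Is012 a b n (leftStr P) → Is012 a b n (rightStr P) → All Simple (bottomStr P)
bottom-simple {a} {b} {n} P left right = no-excess⇒simple (bottomStr P) (ℤP.+-injective (begin
  + Vec.sum (Vec.map excess (bottomStr P))  ≡⟨ weigh-ℕ excess (bottomStr P) ⟨
  weigh (wH excessWeights) (bottomStr P)    ≡⟨ bottom-weight excessWeights balanced P left right ⟩
  ⟨ flagShape a b n ∣ wH excessWeights ⟩    ≡⟨ pairing-vanishes (flagShape a b n) ⟩
  0ℤ                                         ∎))
  where
  balanced : Balanced excessWeights
  balanced = balanced-by-computation excessWeights _

record Counter (stat : Shape → ℕ) : Set where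
  field
    weights  : Weights
    balanced : Balanced weights
    reads    : ∀ σ → ⟨ σ ∣ wH weights ⟩ ≡ + stat σ

count-bottom : ∀ {stat : Shape → ℕ} {a b n} → Counter stat → (P : Puzzle n) →
  Is012 a b n (leftStr P) → Is012 a b n (rightStr P) → All Simple (bottomStr P) →
  stat (shape (bottomStr P)) ≡ stat (flagShape a b n)
count-bottom {stat} {a} {b} {n} counter P left right simple = ℤP.+-injective (begin
  + stat (shape (bottomStr P))        ≡⟨ reads (shape (bottomStr P)) ⟨
  ⟨ shape (bottomStr P) ∣ wH weights ⟩ ≡⟨ weigh-simple (wH weights) (bottomStr P) simple ⟨
  weigh (wH weights) (bottomStr P)    ≡⟨ bottom-weight weights balanced P left right ⟩
  ⟨ flagShape a b n ∣ wH weights ⟩    ≡⟨ reads (flagShape a b n) ⟩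
  + stat (flagShape a b n)            ∎)
  where
  open Counter counter

-- Counters for the 0s, 1s and 2s: their H-weights on simple labels are the
-- unit vectors.
zeros : Counter proj₁
zeros = record
  { weights  = weights
  ; balanced = balanced-by-computation weights _
  ; reads    = λ (p , q , r) → pick (+ p) (+ q) (+ r)
  }
  where
  weights : Weights
  weights = record
    { wH = lookup (1 ∷ 0 ∷ 0 ∷ 0 ∷ 0 ∷ 0 ∷ - 1 ∷ 0 ∷ [])
    ; wA = lookup (0 ∷ 0 ∷ 0 ∷ 1 ∷ 0 ∷ 1 ∷ 1 ∷ 1 ∷ [])
    ; wD = lookup (- 1 ∷ 0 ∷ 0 ∷ - 1 ∷ 0 ∷ - 1 ∷ 0 ∷ - 1 ∷ [])
    }
  pick : ∀ x y z → x * 1ℤ + (y * 0ℤ + z * 0ℤ) ≡ x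
  pick = solve-∀

ones : Counter (proj₁ ∘ proj₂)
ones = record
  { weights  = weights
  ; balanced = balanced-by-computation weights _
  ; reads    = λ (p , q , r) → pick (+ p) (+ q) (+ r)
  }
  where
  weights : Weights
  weights = record
    { wH = lookup (0 ∷ 1 ∷ 0 ∷ 1 ∷ 0 ∷ 0 ∷ 1 ∷ 1 ∷ [])
    ; wA = lookup (0 ∷ 0 ∷ 0 ∷ - 1 ∷ 1 ∷ 0 ∷ 0 ∷ 0 ∷ [])
    ; wD = lookup (0 ∷ - 1 ∷ 0 ∷ 0 ∷ - 1 ∷ 0 ∷ - 1 ∷ - 1 ∷ [])
    }
  pick : ∀ x y z → x * 0ℤ + (y * 1ℤ + z * 0ℤ) ≡ y
  pick = solve-∀

twos : Counter (proj₂ ∘ proj₂)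
twos = record
  { weights  = weights
  ; balanced = balanced-by-computation weights _
  ; reads    = λ (p , q , r) → pick (+ p) (+ q) (+ r)
  }
  where
  weights : Weights
  weights = record
    { wH = lookup (0 ∷ 0 ∷ 1 ∷ 0 ∷ 1 ∷ 1 ∷ 1 ∷ 0 ∷ [])
    ; wA = lookup (0 ∷ 0 ∷ 0 ∷ 0 ∷ - 1 ∷ - 1 ∷ - 1 ∷ - 1 ∷ [])
    ; wD = lookup (0 ∷ 0 ∷ - 1 ∷ 0 ∷ 0 ∷ 0 ∷ 0 ∷ 1 ∷ [])
    }
  pick : ∀ x y z → x * 0ℤ + (y * 0ℤ + z * 1ℤ) ≡ z
  pick = solve-∀

-- The bottom is simple and has the numbers of 0s, 1s and 2s of a 012-string.
lemma5p3 : (a b n : ℕ) → a ≤ b → b ≤ n → (P : Puzzle n) →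
    Is012 a b n (leftStr P) → Is012 a b n (rightStr P) →
    Is012 a b n (bottomStr P)
lemma5p3 a b n _ _ P left right = simple , count zeros , count ones , count twos
  where
  simple : All Simple (bottomStr P)
  simple = bottom-simple P left right

  count : ∀ {stat} → Counter stat → stat (shape (bottomStr P)) ≡ stat (flagShape a b n)
  count counter = count-bottom counter P left right simple
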